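{- Let $k\ge 1$. Given an unweighted undirected graph $G$ with $n$ vertices and $m$ initial edges undergoing only edge deletions, the decremental greedy algorithm maintains a $(2k-1)$-spanner $H$ of $G$ with $O(n^{1+1/k})$ edges, using $O(m)$ total recourse over the whole deletion sequence.
   Context: An $\alpha$-spanner of $G=(V,E)$ is a subgraph $H=(V,E_H)$, $E_H\subseteq E$, with $\operatorname{dist}_G(u,v)\le\operatorname{dist}_H(u,v)\le\alpha\operatorname{dist}_G(u,v)$ for all $u,v$. The greedy algorithm, given an order on $E$, starts with $E_H=\emptyset$ and inspects edges one by one in that order, adding an inspected edge $(u,v)$ to $E_H$ iff currently $\operatorname{dist}_H(u,v)\ge 2k$. The decremental greedy algorithm initializes $H$ as the greedy spanner of the initial graph (for an arbitrary order). When an edge $e=(u,v)$ is deleted from $G$: if $e\notin E_H$, nothing is done; otherwise $e$ is removed from $E_H$, and then the current non-spanner edges $E\setminus E_H$ are inspected one by one in an arbitrary order, each inspected edge $(x,y)$ being added to $E_H$ iff currently $\operatorname{dist}_H(x,y)\ge 2k$. The total recourse is the total number of edges inserted into or removed from $E_H$ over the whole sequence. -}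

module Defs where

open import Data.Nat using (ℕ; zero; suc; _+_; _*_; _∸_; _<_; _≤_)
open import Data.Fin using (Fin)
open import Data.Product using (_×_; _,_; proj₁; proj₂; Σ; ∃-syntax)
open import Data.Sum using (_⊎_)
open import Data.List using (List; []; _∷_; _++_; length)
open import Data.List.Membership.Propositional using (_∈_)
open import Data.List.Relation.Unary.All using (All)
open import Data.List.Relation.Unary.AllPairs using (AllPairs)
open import Data.List.Relation.Binary.Permutation.Propositional using (_↭_)
open import Relation.Binary.PropositionalEquality using (_≡_; _≢_)
open import Relation.Nullary using (¬_)

-- An (undirected) edge on vertex set Fin n, stored as an ordered pair
-- of its two endpoints; (u , v) and (v , u) denote the same edge.
Edge : ℕ → Set
Edge n = Fin n × Fin n

swap : ∀ {n} → Edge n → Edge n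
swap (u , v) = (v , u)

SameEdge : ∀ {n} → Edge n → Edge n → Set
SameEdge e e' = (e ≡ e') ⊎ (swap e ≡ e')

SimpleGraph : ∀ {n} → List (Edge n) → Set
SimpleGraph E = All (λ e → proj₁ e ≢ proj₂ e) E
              × AllPairs (λ e e' → ¬ SameEdge e e') E

Adj : ∀ {n} → List (Edge n) → Fin n → Fin n → Set
Adj E u v = ((u , v) ∈ E) ⊎ ((v , u) ∈ E)

data Walk {n} (E : List (Edge n)) : Fin n → Fin n → ℕ → Set where
  here : ∀ {u} → Walk E u u 0
  step : ∀ {u v w ℓ} → Adj E u v → Walk E v w ℓ → Walk E u w (suc ℓ)

-- dist_E(u,v) ≥ d   (dist = length of a shortest walk, ∞ if none)
DistAtLeast : ∀ {n} → List (Edge n) → Fin n → Fin n → ℕ → Set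
DistAtLeast E u v d = ∀ ℓ → ℓ < d → ¬ Walk E u v ℓ

-- H is an α-spanner of G:  E_H ⊆ E_G and
-- dist_G(u,v) ≤ dist_H(u,v) ≤ α · dist_G(u,v) for all u, v
-- (inequalities between distances, with ∞ for unreachable pairs,
-- unfolded in terms of walks).
IsSpanner : ∀ {n} → ℕ → (H G : List (Edge n)) → Set
IsSpanner {n} α H G =
    (∀ {e} → e ∈ H → e ∈ G)
  × (∀ (u v : Fin n) ℓ → Walk H u v ℓ → ∃[ ℓ' ] (ℓ' ≤ ℓ × Walk G u v ℓ'))
  × (∀ (u v : Fin n) ℓ → Walk G u v ℓ → ∃[ ℓ' ] (ℓ' ≤ α * ℓ × Walk H u v ℓ'))

data GreedyPass {n} (k : ℕ) : List (Edge n) → List (Edge n)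
                            → List (Edge n) → List (Edge n) → Set where
  done : ∀ {H} → GreedyPass k [] H H []
  add  : ∀ {x y es H H' R} → DistAtLeast H x y (2 * k)
       → GreedyPass k es ((x , y) ∷ H) H' R
       → GreedyPass k ((x , y) ∷ es) H H' R
  skip : ∀ {x y es H H' R} → ¬ DistAtLeast H x y (2 * k)
       → GreedyPass k es H H' R
       → GreedyPass k ((x , y) ∷ es) H H' ((x , y) ∷ R)

-- State = (E_H , E ∖ E_H), so the current graph has
-- edge list E_H ++ (E ∖ E_H).
-- Decremental k H N ds trace r : processing the deletion sequence ds
-- from state (H , N) produces the successive states `trace` (one after
-- each deletion) with total recourse r (number of edges inserted into or
-- removed from E_H).  The non-spanner edges are re-inspected in an
-- arbitrary order (any permutation `order` of N).
data Decremental {n} (k : ℕ) : List (Edge n) → List (Edge n) → List (Edge n)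
                  → List (List (Edge n) × List (Edge n)) → ℕ → Set where
  finish  : ∀ {H N} → Decremental k H N [] [] 0
  delNon  : ∀ {H N N' d d' ds tr r}
          → SameEdge d d' → N ↭ d' ∷ N'
          → Decremental k H N' ds tr r
          → Decremental k H N (d ∷ ds) ((H , N') ∷ tr) r
  delSpan : ∀ {H N H₀ H' N' order d d' ds tr r}
          → SameEdge d d' → H ↭ d' ∷ H₀
          → order ↭ N
          → GreedyPass k order H₀ H' N'
          → Decremental k H' N' ds tr r
          → Decremental k H N (d ∷ ds) ((H' , N') ∷ tr)
                        (1 + (length H' ∸ length H₀) + r)

module Submission where

-- Listing the spanner edges newest first, the endpoints of each edge are at distance ≥ 2k in the
-- graph of the edges after it.  Deleting edges only increases distances, so this greedy order
-- survives every update, and it forces girth > 2k.  Peeling vertices of degree ≤ d, either at most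
-- d n edges are removed or a core of minimum degree > d remains, whose non-backtracking walks of
-- length k from one vertex end at d ^ k distinct vertices; optimising d gives |H| ^ k ≤ 3 ^ k n ^ (k+1).
-- A rejected edge had a path of length < 2k in H when it was inspected, and H only grows until the
-- next spanner deletion, so H stays a (2k−1)-spanner.  Finally the potential |H| + 2 |E ∖ H|, at most
-- 3m initially, drops by 2 when a non-spanner edge is deleted and by exactly the recourse 1 + a when a
-- spanner edge is deleted and a edges are re-inserted.

open import Defs
open import Data.Bool using (true; false)
open import Data.Empty using (⊥-elim)
open import Data.Fin using (Fin) renaming (zero to fzero; suc to fsuc; _≟_ to _≟ᶠ_)
open import Data.Fin.Properties using (any?; injective⇒≤)
open import Data.List using (List; []; _∷_; _++_; [_]; length; map; filter; concatMap; lookup; allFin)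
open import Data.List.Properties
  using (length-++; length-map; length-tabulate; filter-accept; filter-reject; filter-all; filter-notAll)
open import Data.List.Membership.Propositional using (_∈_; find)
open import Data.List.Membership.Propositional.Properties
  using (∈-++⁺ˡ; ∈-++⁻; ∈-∃++; ∈-allFin; ∈-filter⁺; ∈-filter⁻; ∈-map⁻; ∈-lookup;
         ∈-concatMap⁻)
open import Data.List.Relation.Unary.Any as Any using (here; there)
open import Data.List.Relation.Unary.All as All using (All; []; _∷_)
open import Data.List.Relation.Unary.All.Properties using (¬Any⇒All¬)
open import Data.List.Relation.Unary.AllPairs using (AllPairs; []; _∷_)
open import Data.List.Relation.Unary.Unique.Propositional using (Unique)
import Data.List.Relation.Unary.Unique.Propositional.Properties as Unique
open import Data.List.Relation.Binary.Disjoint.Propositional using (Disjoint)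
open import Data.List.Relation.Binary.Subset.Propositional using (_⊆_)
open import Data.List.Relation.Binary.Sublist.Propositional as Sublist
  using ([]; _∷_; _∷ʳ_; ⊆-refl; ⊆-trans) renaming (_⊆_ to _⊑_)
open import Data.List.Relation.Binary.Sublist.Propositional.Properties
  using (filter-⊆) renaming (++⁺ to ++⁺ˢ)
open import Data.List.Relation.Binary.Permutation.Propositional
  using (_↭_; ↭-refl; ↭-prep; ↭-sym; ↭-trans)
open import Data.List.Relation.Binary.Permutation.Propositional.Properties
  using (∈-resp-↭; ↭-length; drop-mid)
open import Data.Maybe using (Maybe; just; nothing)
open import Data.Maybe.Properties using (just-injective)
open import Data.Nat
  using (ℕ; zero; suc; _+_; _*_; _∸_; _^_; _/_; _%_; _≤_; _≥_; _<_; z≤n; s≤s; _≤?_)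
open import Data.Nat.Properties
open import Data.Nat.DivMod using (m≡m%n+[m/n]*n; m%n<n; m/n*n≤m)
open import Data.Nat.Induction using (<-wellFounded)
open import Data.Nat.Tactic.RingSolver using (solve-∀)
open import Data.Product using (_×_; _,_; proj₁; proj₂; Σ; ∃-syntax)
open import Data.Product.Properties using (≡-dec)
open import Data.Sum using (_⊎_; inj₁; inj₂)
import Data.Sum as Sum
open import Data.Unit using (⊤; tt)
open import Function using (_∘_; id)
open import Induction.WellFounded using (Acc; acc)
open import Relation.Binary.Definitions using (DecidableEquality)
open import Relation.Binary.PropositionalEquality using (_≡_; _≢_; refl; sym; trans; cong; subst)
open import Relation.Nullary using (Dec; yes; no; ¬_; ¬?; does; _×-dec_; _⊎-dec_)
open import Relation.Unary using (Pred; Decidable)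
open import Relation.Unary.Properties using (∁?)

length-filter-∁ : ∀ {a p} {A : Set a} {P : Pred A p} (P? : Decidable P) xs
                → length xs ≡ length (filter P? xs) + length (filter (∁? P?) xs)
length-filter-∁ P? []       = refl
length-filter-∁ P? (x ∷ xs) with ih ← length-filter-∁ P? xs | does (P? x)
... | true  = cong suc ih
... | false = trans (cong suc ih) (sym (+-suc _ _))

module _ {a} {A : Set a} where

  length-filter-≢ : ∀ (_≟_ : DecidableEquality A) c {xs} → Unique xs
                  → length xs ≤ suc (length (filter (λ x → ¬? (c ≟ x)) xs))
  length-filter-≢ _≟_ c {[]}     _              = z≤n
  length-filter-≢ _≟_ c {x ∷ xs} (x∉xs ∷ unique) with c ≟ x
  ... | yes refl = s≤s (≤-reflexive (cong length (sym (filter-all (λ y → ¬? (c ≟ y)) x∉xs))))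
  ... | no  _    = s≤s (length-filter-≢ _≟_ c unique)

  module _ {b} {B : Set b} (f : A → List B) where

    concatMap-unique : ∀ {xs} → Unique xs → (∀ {x} → x ∈ xs → Unique (f x))
                     → (∀ {x y} → x ∈ xs → y ∈ xs → x ≢ y → Disjoint (f x) (f y))
                     → Unique (concatMap f xs)
    concatMap-unique {[]}     _              _      _        = []
    concatMap-unique {x ∷ xs} (x∉xs ∷ unique) inner disjoint =
      Unique.++⁺ (inner (here refl))
                 (concatMap-unique unique (inner ∘ there)
                                   λ x∈ y∈ → disjoint (there x∈) (there y∈))
                 λ (z∈fx , z∈rest) →
                   let y , y∈xs , z∈fy = find (∈-concatMap⁻ f z∈rest)
                   in disjoint (here refl) (there y∈xs) (All.lookup x∉xs y∈xs) (z∈fx , z∈fy)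

    length-concatMap-≥ : ∀ {m} xs → (∀ {x} → x ∈ xs → m ≤ length (f x))
                       → length xs * m ≤ length (concatMap f xs)
    length-concatMap-≥ []       _     = z≤n
    length-concatMap-≥ (x ∷ xs) large =
      ≤-trans (+-mono-≤ (large (here refl)) (length-concatMap-≥ xs (large ∘ there)))
              (≤-reflexive (sym (length-++ (f x))))

lookup-injective : ∀ {a} {A : Set a} {xs : List A} → Unique xs
                 → ∀ {i j} → lookup xs i ≡ lookup xs j → i ≡ j
lookup-injective (x∉xs ∷ _)   {fzero}  {fzero}  _  = refl
lookup-injective (x∉xs ∷ _)   {fzero}  {fsuc j} eq = ⊥-elim (All.lookup x∉xs (∈-lookup j) eq)
lookup-injective (x∉xs ∷ _)   {fsuc i} {fzero}  eq = ⊥-elim (All.lookup x∉xs (∈-lookup i) (sym eq))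
lookup-injective (_ ∷ unique) {fsuc i} {fsuc j} eq = cong fsuc (lookup-injective unique eq)

length-Unique-Fin : ∀ {n} {xs : List (Fin n)} → Unique xs → length xs ≤ n
length-Unique-Fin unique = injective⇒≤ (lookup-injective unique)

^-distribʳ-* : ∀ a b k → (a * b) ^ k ≡ a ^ k * b ^ k
^-distribʳ-* a b zero    = refl
^-distribʳ-* a b (suc k) =
  trans (cong (a * b *_) (^-distribʳ-* a b k)) (interchange a b (a ^ k) (b ^ k))
  where
    interchange : ∀ a b x y → a * b * (x * y) ≡ a * x * (b * y)
    interchange = solve-∀

private variable
  n ℓ ℓ' d : ℕ
  E F : List (Edge n)
  u v w : Fin n

module _ {n : ℕ} where

  _≟ᵉ_ : DecidableEquality (Edge n)
  _≟ᵉ_ = ≡-dec _≟ᶠ_ _≟ᶠ_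

  open import Data.List.Membership.DecPropositional _≟ᵉ_ using (_∈?_)

  Adj? : ∀ (E : List (Edge n)) u v → Dec (Adj E u v)
  Adj? E u v with (u , v) ∈? E | (v , u) ∈? E
  ... | yes uv | _      = yes (inj₁ uv)
  ... | no _   | yes vu = yes (inj₂ vu)
  ... | no ¬uv | no ¬vu = no λ { (inj₁ uv) → ¬uv uv ; (inj₂ vu) → ¬vu vu }

Adj-sym : Adj E u v → Adj E v u
Adj-sym (inj₁ uv) = inj₂ uv
Adj-sym (inj₂ vu) = inj₁ vu

Adj-mono : E ⊆ F → Adj E u v → Adj F u v
Adj-mono E⊆F (inj₁ uv) = inj₁ (E⊆F uv)
Adj-mono E⊆F (inj₂ vu) = inj₂ (E⊆F vu)

Walk-mono : E ⊆ F → Walk E u v ℓ → Walk F u v ℓ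
Walk-mono E⊆F here         = here
Walk-mono E⊆F (step a wlk) = step (Adj-mono E⊆F a) (Walk-mono E⊆F wlk)

_++ʷ_ : Walk E u v ℓ → Walk E v w ℓ' → Walk E u w (ℓ + ℓ')
here       ++ʷ wlk' = wlk'
step a wlk ++ʷ wlk' = step a (wlk ++ʷ wlk')

snocʷ : Walk E u v ℓ → Adj E v w → Walk E u w (suc ℓ)
snocʷ here       a' = step a' here
snocʷ (step a wlk) a' = step a (snocʷ wlk a')

reverseʷ : Walk E u v ℓ → Walk E v u ℓ
reverseʷ here         = here
reverseʷ (step a wlk) = snocʷ (reverseʷ wlk) (Adj-sym a)

module _ {n : ℕ} where

  Walk? : ∀ (E : List (Edge n)) ℓ u v → Dec (Walk E u v ℓ)
  Walk? E zero u v with u ≟ᶠ v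
  ... | yes refl = yes here
  ... | no u≢v   = no λ { here → u≢v refl }
  Walk? E (suc ℓ) u v with any? (λ w → Adj? E u w ×-dec Walk? E ℓ w v)
  ... | yes (w , a , wlk) = yes (step a wlk)
  ... | no ∄w             = no λ { (step a wlk) → ∄w (_ , a , wlk) }

  ¬DistAtLeast⇒Walk : ∀ {E : List (Edge n)} {u v d} → ¬ DistAtLeast E u v d
                    → ∃[ ℓ ] (ℓ < d × Walk E u v ℓ)
  ¬DistAtLeast⇒Walk {E} {u} {v} {d} ¬dist with anyUpTo? (λ ℓ → Walk? E ℓ u v) d
  ... | yes short = short
  ... | no ¬short = ⊥-elim (¬dist λ ℓ ℓ<d wlk → ¬short (ℓ , ℓ<d , wlk))

DistAtLeast-sym : DistAtLeast E u v d → DistAtLeast E v u d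
DistAtLeast-sym dist ℓ ℓ<d wlk = dist ℓ ℓ<d (reverseʷ wlk)

DistAtLeast-antimono : E ⊆ F → DistAtLeast F u v d → DistAtLeast E u v d
DistAtLeast-antimono E⊆F dist ℓ ℓ<d wlk = dist ℓ ℓ<d (Walk-mono E⊆F wlk)

SameEdge? : (e e' : Edge n) → Dec (SameEdge e e')
SameEdge? e e' = (e ≟ᵉ e') ⊎-dec (swap e ≟ᵉ e')

SameEdge-swapˡ : ∀ {e e' : Edge n} → SameEdge e e' → SameEdge (swap e) e'
SameEdge-swapˡ (inj₁ refl) = inj₂ refl
SameEdge-swapˡ {e = _ , _} (inj₂ refl) = inj₁ refl

SameEdge-swapʳ : ∀ {e e' : Edge n} → SameEdge e e' → SameEdge e (swap e')
SameEdge-swapʳ {e = _ , _} (inj₁ refl) = inj₂ refl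
SameEdge-swapʳ {e = _ , _} (inj₂ refl) = inj₁ refl

Avoids : ∀ {n} {E : List (Edge n)} {u v ℓ} → Edge n → Walk E u v ℓ → Set
Avoids e here                   = ⊤
Avoids e (step {u} {v} _ wlk) = ¬ SameEdge e (u , v) × Avoids e wlk

Avoids-++ : ∀ {e} (wlk : Walk E u v ℓ) {wlk' : Walk E v w ℓ'}
          → Avoids e wlk → Avoids e wlk' → Avoids e (wlk ++ʷ wlk')
Avoids-++ here         _            av' = av'
Avoids-++ (step a wlk) (new , av) av' = new , Avoids-++ wlk av av'

Avoids-snoc : ∀ {e} (wlk : Walk E u v ℓ) {a : Adj E v w}
            → Avoids e wlk → ¬ SameEdge e (v , w) → Avoids e (snocʷ wlk a)
Avoids-snoc here         _          new' = new' , tt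
Avoids-snoc (step a wlk) (new , av) new' = new , Avoids-snoc wlk av new'

Avoids-reverse : ∀ {e} (wlk : Walk E u v ℓ) → Avoids e wlk → Avoids e (reverseʷ wlk)
Avoids-reverse here         _          = tt
Avoids-reverse (step a wlk) (new , av) =
  Avoids-snoc (reverseʷ wlk) (Avoids-reverse wlk av) (new ∘ SameEdge-swapʳ)

Avoids-swap : ∀ {e} (wlk : Walk E u v ℓ) → Avoids e wlk → Avoids (swap e) wlk
Avoids-swap here         _          = tt
Avoids-swap (step a wlk) (new , av) = new ∘ SameEdge-swapˡ , Avoids-swap wlk av

-- Greedily ordered edge lists have large girth

AvoidingWalk : ∀ {n} → List (Edge n) → Edge n → Fin n → Fin n → ℕ → Set
AvoidingWalk L e u v ℓ = Σ (Walk L u v ℓ) (Avoids e)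

Endpoint : ∀ {n} → Edge n → Fin n → Set
Endpoint (x , y) s = s ≡ x ⊎ s ≡ y

GirthAbove : ∀ {n} → ℕ → List (Edge n) → Set
GirthAbove g L = ∀ {p q ℓ} → Adj L p q → (wlk : Walk L q p ℓ) → Avoids (p , q) wlk → g ≤ ℓ

Adj-∷⁻ : ∀ {n} {e : Edge n} {L u v} → Adj (e ∷ L) u v → SameEdge e (u , v) ⊎ Adj L u v
Adj-∷⁻ (inj₁ (here refl)) = inj₁ (inj₁ refl)
Adj-∷⁻ (inj₁ (there uv)) = inj₂ (inj₁ uv)
Adj-∷⁻ (inj₂ (here refl)) = inj₁ (inj₂ refl)
Adj-∷⁻ (inj₂ (there vu)) = inj₂ (inj₂ vu)

SameEdge⇒Endpoints : ∀ {n} {e : Edge n} {u v} → SameEdge e (u , v) → Endpoint e u × Endpoint e v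
SameEdge⇒Endpoints (inj₁ refl) = inj₁ refl , inj₂ refl
SameEdge⇒Endpoints {e = _ , _} (inj₂ refl) = inj₂ refl , inj₁ refl

DistAtLeast-endpoints : ∀ {n} {L : List (Edge n)} {x y s t d}
                      → Endpoint (x , y) s → Endpoint (x , y) t → s ≢ t
                      → DistAtLeast L x y d → DistAtLeast L s t d
DistAtLeast-endpoints (inj₁ refl) (inj₁ refl) s≢t _    = ⊥-elim (s≢t refl)
DistAtLeast-endpoints (inj₁ refl) (inj₂ refl) _   dist = dist
DistAtLeast-endpoints (inj₂ refl) (inj₁ refl) _   dist = DistAtLeast-sym dist
DistAtLeast-endpoints (inj₂ refl) (inj₂ refl) s≢t _    = ⊥-elim (s≢t refl)

-- Cutting a walk in new ∷ L at its first and last use of new leaves two shorter walks in L.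
data Crossing {n} (L : List (Edge n)) (new e : Edge n) (u v : Fin n) (ℓ : ℕ) : Set where
  crossing : ∀ {s t a b} → Endpoint new s → Endpoint new t → a + b < ℓ
           → AvoidingWalk L e u s a → AvoidingWalk L e t v b → Crossing L new e u v ℓ

module _ {n : ℕ} {L : List (Edge n)} {new e : Edge n} where

  dropUnusedEdge : ∀ {u v ℓ} (wlk : Walk (new ∷ L) u v ℓ) → Avoids new wlk → Avoids e wlk
                 → AvoidingWalk L e u v ℓ
  dropUnusedEdge here _ _ = here , tt
  dropUnusedEdge (step a wlk) (fresh , av) (freshₑ , avₑ) with Adj-∷⁻ a
  ... | inj₁ same = ⊥-elim (fresh same)
  ... | inj₂ a'   = let w' , av' = dropUnusedEdge wlk av avₑ in step a' w' , freshₑ , av'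

  splitAtEdge : ∀ {u v ℓ} (wlk : Walk (new ∷ L) u v ℓ) → Avoids e wlk
              → AvoidingWalk L e u v ℓ ⊎ Crossing L new e u v ℓ
  splitAtEdge here _ = inj₁ (here , tt)
  splitAtEdge (step a wlk) (fresh , av) with Adj-∷⁻ a | splitAtEdge wlk av
  ... | inj₂ a' | inj₁ (w' , av') = inj₁ (step a' w' , fresh , av')
  ... | inj₂ a' | inj₂ (crossing s t a+b<ℓ (A , avA) B) =
    inj₂ (crossing s t (s≤s a+b<ℓ) (step a' A , fresh , avA) B)
  ... | inj₁ same | inj₁ B =
    let s , t = SameEdge⇒Endpoints same in inj₂ (crossing s t ≤-refl (here , tt) B)
  ... | inj₁ same | inj₂ (crossing {a = a} {b} _ t a+b<ℓ _ B) =
    let s , _ = SameEdge⇒Endpoints same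
    in inj₂ (crossing s t (s≤s (≤-trans (m≤n+m b a) (<⇒≤ a+b<ℓ))) (here , tt) B)

module GreedyOrder {n : ℕ} (g : ℕ) where

  GreedyOrdered : List (Edge n) → Set
  GreedyOrdered []            = ⊤
  GreedyOrdered ((x , y) ∷ L) = DistAtLeast L x y g × GreedyOrdered L

  GreedyOrdered-⊑ : ∀ {L' L} → L' ⊑ L → GreedyOrdered L → GreedyOrdered L'
  GreedyOrdered-⊑ []       _ = tt
  GreedyOrdered-⊑ (_ ∷ʳ τ) (_ , greedy) = GreedyOrdered-⊑ τ greedy
  GreedyOrdered-⊑ {_ ∷ _} (refl ∷ τ) (dist , greedy) =
    DistAtLeast-antimono (Sublist.lookup τ) dist , GreedyOrdered-⊑ τ greedy

  greedyOrdered⇒girthAbove : ∀ {L} → GreedyOrdered L → GirthAbove g L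
  greedyOrdered⇒girthAbove {[]} _ (inj₁ ())
  greedyOrdered⇒girthAbove {[]} _ (inj₂ ())
  greedyOrdered⇒girthAbove {(x , y) ∷ L} (dist , greedy) a wlk av with Adj-∷⁻ a
  ... | inj₁ (inj₁ refl) =
    ≮⇒≥ λ ℓ<g → dist _ ℓ<g (reverseʷ (proj₁ (dropUnusedEdge wlk av av)))
  ... | inj₁ (inj₂ refl) =
    ≮⇒≥ λ ℓ<g → dist _ ℓ<g (proj₁ (dropUnusedEdge wlk (Avoids-swap wlk av) av))
  ... | inj₂ a' with splitAtEdge wlk av
  ...   | inj₁ (w' , av') = greedyOrdered⇒girthAbove greedy a' w' av'
  ...   | inj₂ (crossing {s} {t} {a} {b} s-end t-end a+b<ℓ (A , avA) (B , avB)) with s ≟ᶠ t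
  ...     | yes refl =
    ≤-trans (greedyOrdered⇒girthAbove greedy a' (A ++ʷ B) (Avoids-++ A avA avB)) (<⇒≤ a+b<ℓ)
  ...     | no s≢t = ≮⇒≥ λ ℓ<g →
    DistAtLeast-endpoints s-end t-end s≢t dist _
      (≤-<-trans (≤-reflexive (+-suc a b)) (≤-<-trans a+b<ℓ ℓ<g))
      (reverseʷ A ++ʷ step (Adj-sym a') (reverseʷ B))

  greedyOrdered⇒simple : ∀ {L} → 1 < g → GreedyOrdered L → AllPairs (λ e e' → ¬ SameEdge e e') L
  greedyOrdered⇒simple {[]} _ _ = []
  greedyOrdered⇒simple {(x , y) ∷ L} 1<g (dist , greedy) =
    All.tabulate (λ e'∈L same → dist 1 1<g (step (adj e'∈L same) here))
      ∷ greedyOrdered⇒simple 1<g greedy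
    where
      adj : ∀ {e'} → e' ∈ L → SameEdge (x , y) e' → Adj L x y
      adj e'∈L (inj₁ refl) = inj₁ e'∈L
      adj e'∈L (inj₂ refl) = inj₂ e'∈L

module _ {n : ℕ} where

  incident? : (u : Fin n) → Decidable (λ e → Endpoint e u)
  incident? u (x , y) = (u ≟ᶠ x) ⊎-dec (u ≟ᶠ y)

  otherEnd : Fin n → Edge n → Fin n
  otherEnd u (x , y) with x ≟ᶠ u
  ... | yes _ = y
  ... | no  _ = x

  otherEnd-spec : ∀ {e u} → Endpoint e u → e ≡ (u , otherEnd u e) ⊎ e ≡ (otherEnd u e , u)
  otherEnd-spec {x , y} {u} u∈e with x ≟ᶠ u | u∈e
  ... | yes refl | _          = inj₁ refl
  ... | no x≢u   | inj₁ refl  = ⊥-elim (x≢u refl)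
  ... | no _     | inj₂ refl  = inj₂ refl

  neighbours : Fin n → List (Edge n) → List (Fin n)
  neighbours u L = map (otherEnd u) (filter (incident? u) L)

  deleteVertex : Fin n → List (Edge n) → List (Edge n)
  deleteVertex u L = filter (∁? (incident? u)) L

  length-deleteVertex : ∀ u L → length L ≡ length (neighbours u L) + length (deleteVertex u L)
  length-deleteVertex u L = trans (length-filter-∁ (incident? u) L)
                                  (cong (_+ length (deleteVertex u L))
                                        (sym (length-map (otherEnd u) (filter (incident? u) L))))

  otherEnd-adjacent : ∀ {e u L} → e ∈ L → Endpoint e u → Adj L u (otherEnd u e)
  otherEnd-adjacent e∈L u∈e with otherEnd-spec u∈e
  ... | inj₁ e≡ = inj₁ (subst (_∈ _) e≡ e∈L)
  ... | inj₂ e≡ = inj₂ (subst (_∈ _) e≡ e∈L)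

  otherEnd-injective : ∀ {e e' u} → Endpoint e u → Endpoint e' u → otherEnd u e ≡ otherEnd u e'
                     → SameEdge e e'
  otherEnd-injective {u = u} u∈e u∈e' eq with otherEnd-spec u∈e | otherEnd-spec u∈e'
  ... | inj₁ e≡ | inj₁ e'≡ = inj₁ (trans e≡ (trans (cong (u ,_) eq) (sym e'≡)))
  ... | inj₁ e≡ | inj₂ e'≡ = inj₂ (trans (cong swap e≡) (trans (cong (_, u) eq) (sym e'≡)))
  ... | inj₂ e≡ | inj₁ e'≡ = inj₂ (trans (cong swap e≡) (trans (cong (u ,_) eq) (sym e'≡)))
  ... | inj₂ e≡ | inj₂ e'≡ = inj₁ (trans e≡ (trans (cong (_, u) eq) (sym e'≡)))

  ∈-neighbours⁻ : ∀ {u a} L → a ∈ neighbours u L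
                → ∃[ e ] (e ∈ L × Endpoint e u × a ≡ otherEnd u e)
  ∈-neighbours⁻ {u} L a∈ with e , e∈ , refl ← ∈-map⁻ (otherEnd u) a∈ =
    let e∈L , u∈e = ∈-filter⁻ (incident? u) e∈ in e , e∈L , u∈e , refl

  neighbours-adjacent : ∀ {u a} L → a ∈ neighbours u L → Adj L u a
  neighbours-adjacent L a∈ with _ , e∈L , u∈e , refl ← ∈-neighbours⁻ L a∈ =
    otherEnd-adjacent e∈L u∈e

  neighbours-unique : ∀ {u} L → AllPairs (λ e e' → ¬ SameEdge e e') L → Unique (neighbours u L)
  neighbours-unique [] _ = []
  neighbours-unique {u} (e ∷ L) (distinct ∷ simple) with incident? u e
  ... | no  u∉e rewrite filter-reject (incident? u) {xs = L} u∉e = neighbours-unique L simple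
  ... | yes u∈e rewrite filter-accept (incident? u) {xs = L} u∈e =
    All.tabulate fresh ∷ neighbours-unique L simple
    where
      fresh : ∀ {a} → a ∈ neighbours u L → otherEnd u e ≢ a
      fresh a∈ refl with e' , e'∈L , u∈e' , eq ← ∈-neighbours⁻ L a∈ =
        All.lookup distinct e'∈L (otherEnd-injective u∈e u∈e' eq)

  degree : Fin n → List (Edge n) → ℕ
  degree u L = length (neighbours u L)

  MinDegreeAbove : ℕ → List (Edge n) → Set
  MinDegreeAbove d L = ∀ {u a} → a ∈ neighbours u L → d < degree a L

-- Non-backtracking walks and the Moore bound

¬SameEdge-fork : ∀ {n} {u a b : Fin n} → a ≢ b → ¬ SameEdge (u , a) (b , u)
¬SameEdge-fork a≢b (inj₁ eq) = a≢b (trans (cong proj₂ eq) (cong proj₁ eq))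
¬SameEdge-fork a≢b (inj₂ eq) = a≢b (cong proj₁ eq)

module NonBacktracking {n : ℕ} {g : ℕ} (L : List (Edge n)) (girth : GirthAbove g L) where

  -- NBWalk p u x j: a walk of length j from u to x that never immediately reverses a step;
  -- p is the vertex the walk has just come from, if any.
  data NBWalk : Maybe (Fin n) → Fin n → Fin n → ℕ → Set where
    []   : ∀ {p u} → NBWalk p u u 0
    cons : ∀ {p u a x j} → Adj L u a → p ≢ just a → NBWalk (just u) a x j → NBWalk p u x (suc j)

  toWalk : ∀ {p u x j} → NBWalk p u x j → Walk L u x j
  toWalk []             = here
  toWalk (cons a _ wlk) = step a (toWalk wlk)

  -- The last field says that the step s → t does not backtrack along W.
  data FirstUse (e : Edge n) (p : Maybe (Fin n)) (u : Fin n) (j : ℕ) : Set where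
    firstUse : ∀ {s t j'} → SameEdge e (s , t) → j' < j
             → (W : NBWalk p u s j') → Avoids e (toWalk W) → (j' ≡ 0 → p ≢ just t)
             → FirstUse e p u j

  avoidsOrFirstUse : ∀ e {p u x j} (W : NBWalk p u x j) → Avoids e (toWalk W) ⊎ FirstUse e p u j
  avoidsOrFirstUse e [] = inj₁ tt
  avoidsOrFirstUse e {u = u} (cons {a = a} adj p≢a W) with SameEdge? e (u , a)
  ... | yes same = inj₂ (firstUse same (s≤s z≤n) [] tt λ _ → p≢a)
  ... | no fresh with avoidsOrFirstUse e W
  ...   | inj₁ av = inj₁ (fresh , av)
  ...   | inj₂ (firstUse same j'<j W' av' _) =
    inj₂ (firstUse same (s≤s j'<j) (cons adj p≢a W') (fresh , av') λ ())

  closedNBWalk-long : ∀ {u a j} → Adj L u a → NBWalk (just u) a u j → g ≤ j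
  closedNBWalk-long = go (<-wellFounded _)
    where
      go : ∀ {u a j} → Acc _<_ j → Adj L u a → NBWalk (just u) a u j → g ≤ j
      go {u} {a} (acc smaller) adj W with avoidsOrFirstUse (u , a) W
      ... | inj₁ av = girth adj (toWalk W) av
      ... | inj₂ (firstUse (inj₁ refl) j'<j W' av' _) =
        ≤-trans (girth adj (toWalk W') av') (<⇒≤ j'<j)
      ... | inj₂ (firstUse (inj₂ refl) _ [] _ u≢u) = ⊥-elim (u≢u refl refl)
      ... | inj₂ (firstUse (inj₂ refl) j'<j (cons {j = j''} adj' _ W'') _ _) =
        let j''<j = ≤-trans (n≤1+n (suc j'')) j'<j
        in ≤-trans (go (smaller j''<j) adj' W'') (<⇒≤ j''<j)

  returnWalk : ∀ {u b y j} → Adj L u b → NBWalk (just u) b y j → Walk L y u (suc j)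
  returnWalk ub W = snocʷ (reverseʷ (toWalk W)) (Adj-sym ub)

  returnWalk-avoids : ∀ {u a b y j} (ub : Adj L u b) (W : NBWalk (just u) b y j) → a ≢ b
                    → Avoids (u , a) (toWalk W) → Avoids (u , a) (returnWalk ub W)
  returnWalk-avoids ub W a≢b av =
    Avoids-snoc (reverseʷ (toWalk W)) (Avoids-reverse (toWalk W) av) (¬SameEdge-fork a≢b)

  forkedNBWalks-long : ∀ {u a b x j₁ j₂} → Adj L u a → Adj L u b → a ≢ b
                     → NBWalk (just u) a x j₁ → NBWalk (just u) b x j₂ → g ≤ j₁ + suc j₂
  forkedNBWalks-long {u} {a} {j₁ = j₁} {j₂} ua ub a≢b W₁ W₂ with avoidsOrFirstUse (u , a) W₁
  ... | inj₂ (firstUse (inj₁ refl) j'<j₁ W₁' av _) =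
    ≤-trans (girth ua (toWalk W₁') av) (m≤n⇒m≤n+o (suc j₂) (<⇒≤ j'<j₁))
  ... | inj₂ (firstUse (inj₂ refl) _ [] _ u≢u) = ⊥-elim (u≢u refl refl)
  ... | inj₂ (firstUse (inj₂ refl) j'<j₁ (cons {j = j''} adj' _ W₁'') _ _) =
    ≤-trans (closedNBWalk-long adj' W₁'')
            (m≤n⇒m≤n+o (suc j₂) (≤-trans (n≤1+n j'') (<⇒≤ j'<j₁)))
  ... | inj₁ av₁ with avoidsOrFirstUse (u , a) W₂
  ...   | inj₁ av₂ =
    girth ua (toWalk W₁ ++ʷ returnWalk ub W₂)
             (Avoids-++ (toWalk W₁) av₁ (returnWalk-avoids ub W₂ a≢b av₂))
  ...   | inj₂ (firstUse (inj₁ refl) j'<j₂ W₂' _ _) =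
    ≤-trans (closedNBWalk-long ub W₂') (m≤n⇒m≤o+n j₁ (≤-trans (<⇒≤ j'<j₂) (n≤1+n j₂)))
  ...   | inj₂ (firstUse (inj₂ refl) j'<j₂ W₂' av₂ _) =
    ≤-trans (girth ua (returnWalk ub W₂') (returnWalk-avoids ub W₂' a≢b av₂))
            (m≤n⇒m≤o+n j₁ (≤-trans j'<j₂ (n≤1+n j₂)))

  module _ (simple : AllPairs (λ e e' → ¬ SameEdge e e') L) where

    children : Maybe (Fin n) → Fin n → List (Fin n)
    children nothing  u = neighbours u L
    children (just v) u = filter (λ a → ¬? (v ≟ᶠ a)) (neighbours u L)

    ∈-children⁻ : ∀ p {u a} → a ∈ children p u → a ∈ neighbours u L × p ≢ just a
    ∈-children⁻ nothing a∈ = a∈ , λ ()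
    ∈-children⁻ (just v) a∈ =
      let a∈N , v≢a = ∈-filter⁻ (λ a → ¬? (v ≟ᶠ a)) a∈ in a∈N , v≢a ∘ just-injective

    children-unique : ∀ p u → Unique (children p u)
    children-unique nothing  u = neighbours-unique L simple
    children-unique (just v) u = Unique.filter⁺ (λ a → ¬? (v ≟ᶠ a)) (neighbours-unique L simple)

    length-children : ∀ {d} p u → d < degree u L → d ≤ length (children p u)
    length-children nothing  u d<deg = <⇒≤ d<deg
    length-children (just v) u d<deg =
      ≤-pred (≤-trans d<deg (length-filter-≢ _≟ᶠ_ v (neighbours-unique L simple)))

    leaves : Maybe (Fin n) → Fin n → ℕ → List (Fin n)
    leaves p u zero    = [ u ]
    leaves p u (suc j) = concatMap (λ a → leaves (just u) a j) (children p u)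

    leaves-NBWalk : ∀ j {p u x} → x ∈ leaves p u j → NBWalk p u x j
    leaves-NBWalk zero    (here refl) = []
    leaves-NBWalk (suc j) {p} {u} x∈ =
      let a , a∈ , x∈' = find (∈-concatMap⁻ (λ a → leaves (just u) a j) {xs = children p u} x∈)
          a∈N , p≢a = ∈-children⁻ p a∈
      in cons (neighbours-adjacent L a∈N) p≢a (leaves-NBWalk j x∈')

    leaves-unique : ∀ j p u → 2 * j ≤ g → Unique (leaves p u j)
    leaves-unique zero    p u _    = [] ∷ []
    leaves-unique (suc j) p u 2j≤g =
      concatMap-unique (λ a → leaves (just u) a j) (children-unique p u)
        (λ _ → leaves-unique j (just u) _ (≤-trans (*-monoʳ-≤ 2 (n≤1+n j)) 2j≤g))
        λ a∈ b∈ a≢b (x∈a , x∈b) →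
          let long = forkedNBWalks-long (adjacent a∈) (adjacent b∈) a≢b
                                        (leaves-NBWalk j x∈a) (leaves-NBWalk j x∈b)
          in 1+n≰n (≤-trans (≤-reflexive (cong (λ m → suc (j + suc m)) (sym (+-identityʳ j))))
                            (≤-trans 2j≤g long))
      where
        adjacent : ∀ {a} → a ∈ children p u → Adj L u a
        adjacent = neighbours-adjacent L ∘ proj₁ ∘ ∈-children⁻ p

    leaves-length : ∀ {d} → MinDegreeAbove d L
                  → ∀ j p u → d < degree u L → d ^ j ≤ length (leaves p u j)
    leaves-length minDegree zero    p u _     = ≤-refl
    leaves-length {d} minDegree (suc j) p u d<deg =
      ≤-trans (*-monoˡ-≤ (d ^ j) (length-children p u d<deg))
              (length-concatMap-≥ (λ a → leaves (just u) a j) (children p u)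
                 λ a∈ → leaves-length minDegree j (just u) _
                                      (minDegree (proj₁ (∈-children⁻ p a∈))))

    moore-bound : ∀ {d k r} → 2 * k ≤ g → MinDegreeAbove d L → d < degree r L → d ^ k ≤ n
    moore-bound {k = k} {r} 2k≤g minDegree d<deg =
      ≤-trans (leaves-length minDegree k nothing r d<deg)
              (length-Unique-Fin (leaves-unique k nothing r 2k≤g))

-- Peeling

module _ {n : ℕ} where

  EndpointsIn : List (Fin n) → List (Edge n) → Set
  EndpointsIn V L = ∀ {x y} → (x , y) ∈ L → x ∈ V × y ∈ V

  neighbours-∈ : ∀ {V L u a} → EndpointsIn V L → a ∈ neighbours u L → a ∈ V
  neighbours-∈ {L = L} ends a∈ with neighbours-adjacent L a∈
  ... | inj₁ ua∈L = proj₂ (ends ua∈L)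
  ... | inj₂ au∈L = proj₁ (ends au∈L)

  HasCoreAbove : ℕ → List (Edge n) → Set
  HasCoreAbove d L = ∃[ L' ] (L' ⊑ L × MinDegreeAbove d L' × ∃[ r ] (d < degree r L'))

  _─_ : List (Fin n) → Fin n → List (Fin n)
  V ─ v = filter (λ w → ¬? (v ≟ᶠ w)) V

  -- Peeling off a vertex of degree ≤ d loses at most d edges.
  sparseOrCore : ∀ d V L → EndpointsIn V L → length L ≤ d * length V ⊎ HasCoreAbove d L
  sparseOrCore d V = go V (<-wellFounded (length V))
    where
      core : ∀ {V} L → EndpointsIn V L → All (λ v → ¬ degree v L ≤ d) V
           → length L ≤ d * length V ⊎ HasCoreAbove d L
      core []            _    _     = inj₁ z≤n
      core ((x , y) ∷ L) ends dense =
        inj₂ (_ , ⊆-refl , large ∘ neighbours-∈ ends , x , large (proj₁ (ends (here refl))))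
        where
          large : ∀ {v} → v ∈ _ → d < degree v ((x , y) ∷ L)
          large v∈V = ≰⇒> (All.lookup dense v∈V)

      go : ∀ V → Acc _<_ (length V) → ∀ L → EndpointsIn V L
         → length L ≤ d * length V ⊎ HasCoreAbove d L
      go V (acc smaller) L ends with Any.any? (λ v → degree v L ≤? d) V
      ... | no ¬sparse = core L ends (¬Any⇒All¬ V ¬sparse)
      ... | yes sparse with v , v∈V , deg≤d ← find sparse =
        Sum.map bound (λ (L' , L'⊑ , core') → L' , ⊆-trans L'⊑ (filter-⊆ _ L) , core')
                (go (V ─ v) (smaller shorter) (deleteVertex v L) ends')
        where
          shorter : length (V ─ v) < length V
          shorter = filter-notAll (λ w → ¬? (v ≟ᶠ w)) V (Any.map (λ v≡w v≢w → v≢w v≡w) v∈V)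
          ends' : EndpointsIn (V ─ v) (deleteVertex v L)
          ends' e∈ with e∈L , v∉e ← ∈-filter⁻ (∁? (incident? v)) e∈ =
            let x∈V , y∈V = ends e∈L
            in ∈-filter⁺ _ x∈V (v∉e ∘ inj₁) , ∈-filter⁺ _ y∈V (v∉e ∘ inj₂)
          bound : length (deleteVertex v L) ≤ d * length (V ─ v) → length L ≤ d * length V
          bound rest = begin
            length L                               ≡⟨ length-deleteVertex v L ⟩
            degree v L + length (deleteVertex v L) ≤⟨ +-mono-≤ deg≤d rest ⟩
            d + d * length (V ─ v)                 ≡⟨ *-suc d _ ⟨
            d * suc (length (V ─ v))               ≤⟨ *-monoʳ-≤ d shorter ⟩
            d * length V                           ∎
            where open ≤-Reasoning

power-bound : ∀ c {m d n} k → m ≤ c * (d * n) → d ^ k ≤ n → m ^ k ≤ c ^ k * n ^ (k + 1)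
power-bound c {m} {d} {n} k m≤cdn dᵏ≤n = begin
  m ^ k                   ≤⟨ ^-monoˡ-≤ k m≤cdn ⟩
  (c * (d * n)) ^ k       ≡⟨ ^-distribʳ-* c (d * n) k ⟩
  c ^ k * (d * n) ^ k     ≡⟨ cong (c ^ k *_) (^-distribʳ-* d n k) ⟩
  c ^ k * (d ^ k * n ^ k) ≤⟨ *-monoʳ-≤ (c ^ k) (*-monoˡ-≤ (n ^ k) dᵏ≤n) ⟩
  c ^ k * (n * n ^ k)     ≡⟨ cong (λ e → c ^ k * n ^ e) (+-comm 1 k) ⟩
  c ^ k * n ^ (k + 1)     ∎
  where open ≤-Reasoning

-- With q = ⌊m / n⌋ ≥ 2 the hypothesis fails for d = q - 1, so d ^ k ≤ n, while m < (d + 2) n ≤ 3 d n.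
sparse⇒power-bound : ∀ {m n k} → 1 ≤ k → (∀ d → m ≤ d * n ⊎ d ^ k ≤ n)
                   → m ^ k ≤ 3 ^ k * n ^ (k + 1)
sparse⇒power-bound {m} {zero} {suc k} _ sparse with sparse 1
... | inj₁ m≤0 rewrite n≤0⇒n≡0 (≤-trans m≤0 (≤-reflexive (*-zeroʳ 1))) = z≤n
... | inj₂ 1ᵏ≤0 = ⊥-elim (1+n≰n (≤-trans (≤-reflexive (sym (^-zeroˡ (suc k)))) 1ᵏ≤0))
sparse⇒power-bound {m} {n@(suc _)} {k} _ sparse =
  let d , m≤3dn , dᵏ≤n = fromQuotient (m / n) (m/n*n≤m m n) m<[1+m/n]n
  in power-bound 3 k m≤3dn dᵏ≤n
  where
    m<[1+m/n]n : m < suc (m / n) * n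
    m<[1+m/n]n = begin-strict
      m                   ≡⟨ m≡m%n+[m/n]*n m n ⟩
      m % n + m / n * n   <⟨ +-monoˡ-< (m / n * n) (m%n<n m n) ⟩
      n + m / n * n       ∎
      where open ≤-Reasoning

    1ᵏ≤n : 1 ^ k ≤ n
    1ᵏ≤n = subst (_≤ n) (sym (^-zeroˡ k)) (s≤s z≤n)

    3n≡3[1n] : 3 * n ≡ 3 * (1 * n)
    3n≡3[1n] = *-assoc 3 1 n

    fromQuotient : ∀ q → q * n ≤ m → m < suc q * n → ∃[ d ] (m ≤ 3 * (d * n) × d ^ k ≤ n)
    fromQuotient zero _ m<n =
      1 , ≤-trans (<⇒≤ m<n) (≤-trans (*-monoˡ-≤ n {1} {3} (s≤s z≤n)) (≤-reflexive 3n≡3[1n]))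
        , 1ᵏ≤n
    fromQuotient (suc zero) _ m<2n =
      1 , ≤-trans (<⇒≤ m<2n) (≤-trans (*-monoˡ-≤ n {2} {3} (s≤s (s≤s z≤n))) (≤-reflexive 3n≡3[1n]))
        , 1ᵏ≤n
    fromQuotient (suc (suc d)) qn≤m m<[3+d]n with sparse (suc d)
    ... | inj₁ m≤[1+d]n =
      ⊥-elim (<⇒≱ (<-≤-trans (*-monoˡ-< n {suc d} {suc (suc d)} ≤-refl) qn≤m) m≤[1+d]n)
    ... | inj₂ dᵏ≤n = suc d , m≤3[1+d]n , dᵏ≤n
      where
        m≤3[1+d]n : m ≤ 3 * (suc d * n)
        m≤3[1+d]n = begin
          m                 ≤⟨ <⇒≤ m<[3+d]n ⟩
          (3 + d) * n       ≤⟨ *-monoˡ-≤ n (+-monoʳ-≤ 3 (m≤n*m d 3)) ⟩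
          (3 + 3 * d) * n   ≡⟨ cong (_* n) (*-suc 3 d) ⟨
          3 * suc d * n     ≡⟨ *-assoc 3 (suc d) n ⟩
          3 * (suc d * n)   ∎
          where open ≤-Reasoning

-- The decremental greedy algorithm

Spans : ∀ {n} → ℕ → List (Edge n) → List (Edge n) → Set
Spans α H N = ∀ {x y} → (x , y) ∈ N → ∃[ ℓ ] (ℓ ≤ α × Walk H x y ℓ)

spans⇒isSpanner : ∀ {n α} {H N : List (Edge n)} → 1 ≤ α → Spans α H N → IsSpanner α H (H ++ N)
spans⇒isSpanner {n} {α} {H} {N} 1≤α spans =
  ∈-++⁺ˡ , (λ _ _ ℓ wlk → ℓ , ≤-refl , Walk-mono ∈-++⁺ˡ wlk) , stretch
  where
    shortcut : ∀ {x y} → (x , y) ∈ H ++ N → ∃[ ℓ ] (ℓ ≤ α × Walk H x y ℓ)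
    shortcut xy∈ with ∈-++⁻ H xy∈
    ... | inj₁ xy∈H = 1 , 1≤α , step (inj₁ xy∈H) here
    ... | inj₂ xy∈N = spans xy∈N

    detour : ∀ {u v} → Adj (H ++ N) u v → ∃[ ℓ ] (ℓ ≤ α × Walk H u v ℓ)
    detour (inj₁ uv∈) = shortcut uv∈
    detour (inj₂ vu∈) = let ℓ , ℓ≤α , wlk = shortcut vu∈ in ℓ , ℓ≤α , reverseʷ wlk

    stretch : ∀ (u v : Fin n) ℓ → Walk (H ++ N) u v ℓ
            → ∃[ ℓ' ] (ℓ' ≤ α * ℓ × Walk H u v ℓ')
    stretch u .u zero    here         = 0 , z≤n , here
    stretch u v  (suc ℓ) (step a wlk) =
      let ℓ₁ , ℓ₁≤α , w₁ = detour a
          ℓ₂ , ℓ₂≤αℓ , w₂ = stretch _ v ℓ wlk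
      in ℓ₁ + ℓ₂ , ≤-trans (+-mono-≤ ℓ₁≤α ℓ₂≤αℓ) (≤-reflexive (sym (*-suc α ℓ)))
                 , w₁ ++ʷ w₂

-- h, h₀, h' are the spanner sizes before and after deleting a spanner edge and after the
-- greedy pass; m, m' are the numbers of non-spanner edges before and after.
recourse-step : ∀ {h h₀ h' m m' r} → h ≡ suc h₀ → h' + m' ≡ h₀ + m → h₀ ≤ h'
              → r ≤ h' + 2 * m' → 1 + (h' ∸ h₀) + r ≤ h + 2 * m
recourse-step {h₀ = h₀} {m = m} {m'} {r} refl conserve h₀≤h' r≤
  with a , refl ← m≤n⇒∃[o]m+o≡n h₀≤h' rewrite m+n∸m≡n h₀ a = begin
    1 + a + r                    ≤⟨ +-monoʳ-≤ (1 + a) r≤ ⟩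
    1 + a + (h₀ + a + 2 * m')    ≡⟨ regroup h₀ a m' ⟩
    suc h₀ + 2 * (a + m')        ≡⟨ cong (λ x → suc h₀ + 2 * x) a+m'≡m ⟩
    suc h₀ + 2 * m               ∎
  where
    open ≤-Reasoning
    regroup : ∀ h₀ a m' → 1 + a + (h₀ + a + 2 * m') ≡ suc h₀ + 2 * (a + m')
    regroup = solve-∀
    a+m'≡m : a + m' ≡ m
    a+m'≡m = +-cancelˡ-≡ h₀ _ _ (trans (sym (+-assoc h₀ a m')) conserve)

module DecrementalGreedy {n : ℕ} (k : ℕ) (k≥1 : 1 ≤ k) where
  open GreedyOrder {n} (2 * k)

  private variable
    order H H' H₀ N R : List (Edge n)

  HasGreedyOrder : List (Edge n) → Set
  HasGreedyOrder H = ∃[ L ] (L ↭ H × GreedyOrdered L)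

  GreedyOrdered-sparse : ∀ {L} → GreedyOrdered L → ∀ d → length L ≤ d * n ⊎ d ^ k ≤ n
  GreedyOrdered-sparse {L} greedy d with sparseOrCore d (allFin n) L (λ _ → ∈-allFin _ , ∈-allFin _)
  ... | inj₁ sparse = inj₁ (subst (λ m → length L ≤ d * m) (length-tabulate id) sparse)
  ... | inj₂ (L' , L'⊑L , minDegree , r , d<deg) =
    let greedy' = GreedyOrdered-⊑ L'⊑L greedy
    in inj₂ (NonBacktracking.moore-bound L' (greedyOrdered⇒girthAbove greedy')
                                      (greedyOrdered⇒simple (*-monoʳ-≤ 2 k≥1) greedy')
                                      {k = k} ≤-refl minDegree d<deg)

  HasGreedyOrder-size : HasGreedyOrder H → length H ^ k ≤ 3 ^ k * n ^ (k + 1)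
  HasGreedyOrder-size (L , L↭H , greedy) =
    subst (λ m → m ^ k ≤ 3 ^ k * n ^ (k + 1)) (↭-length L↭H)
          (sparse⇒power-bound k≥1 (GreedyOrdered-sparse greedy))

  HasGreedyOrder-delete : ∀ {d} → H ↭ d ∷ H₀ → HasGreedyOrder H → HasGreedyOrder H₀
  HasGreedyOrder-delete {d = d} H↭ (L , L↭H , greedy)
    with A , B , refl ← ∈-∃++ (∈-resp-↭ (↭-sym (↭-trans L↭H H↭)) (here refl)) =
    A ++ B , drop-mid A [] (↭-trans L↭H H↭)
           , GreedyOrdered-⊑ (++⁺ˢ ⊆-refl (d ∷ʳ ⊆-refl)) greedy

  GreedyPass-⊆ : GreedyPass k order H H' R → H ⊆ H'
  GreedyPass-⊆ done          = id
  GreedyPass-⊆ (add _ pass)  = GreedyPass-⊆ pass ∘ there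
  GreedyPass-⊆ (skip _ pass) = GreedyPass-⊆ pass

  GreedyPass-grows : GreedyPass k order H H' R → length H ≤ length H'
  GreedyPass-grows done          = ≤-refl
  GreedyPass-grows (add _ pass)  = ≤-trans (n≤1+n _) (GreedyPass-grows pass)
  GreedyPass-grows (skip _ pass) = GreedyPass-grows pass

  GreedyPass-length : GreedyPass k order H H' R
                    → length H' + length R ≡ length H + length order
  GreedyPass-length done = refl
  GreedyPass-length {_ ∷ order} {H} (add _ pass) =
    trans (GreedyPass-length pass) (sym (+-suc (length H) (length order)))
  GreedyPass-length {_ ∷ order} {H} {H'} {_ ∷ R} (skip _ pass) =
    trans (+-suc (length H') (length R))
          (trans (cong suc (GreedyPass-length pass)) (sym (+-suc (length H) (length order))))

  GreedyPass-spans : GreedyPass k order H H' R → Spans (2 * k ∸ 1) H' R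
  GreedyPass-spans (add _ pass)     xy∈R         = GreedyPass-spans pass xy∈R
  GreedyPass-spans (skip close pass) (here refl) =
    let ℓ , ℓ<2k , wlk = ¬DistAtLeast⇒Walk close
    in ℓ , <⇒≤pred ℓ<2k , Walk-mono (GreedyPass-⊆ pass) wlk
  GreedyPass-spans (skip _ pass)    (there xy∈R) = GreedyPass-spans pass xy∈R

  GreedyPass-greedy : GreedyPass k order H H' R → HasGreedyOrder H → HasGreedyOrder H'
  GreedyPass-greedy done greedy = greedy
  GreedyPass-greedy (add far pass) (L , L↭H , greedy) =
    GreedyPass-greedy pass
      (_ ∷ L , ↭-prep _ L↭H , DistAtLeast-antimono (∈-resp-↭ L↭H) far , greedy)
  GreedyPass-greedy (skip _ pass) greedy = GreedyPass-greedy pass greedy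

  SmallSpanner : List (Edge n) × List (Edge n) → Set
  SmallSpanner s = IsSpanner (2 * k ∸ 1) (proj₁ s) (proj₁ s ++ proj₂ s)
                 × length (proj₁ s) ^ k ≤ 3 ^ k * n ^ (k + 1)

  smallSpanner : HasGreedyOrder H → Spans (2 * k ∸ 1) H N → SmallSpanner (H , N)
  smallSpanner greedy spans =
    spans⇒isSpanner (∸-monoˡ-≤ 1 (*-monoʳ-≤ 2 k≥1)) spans , HasGreedyOrder-size greedy

  decremental-sound : ∀ {ds trace r} → Decremental k H N ds trace r
                    → HasGreedyOrder H → Spans (2 * k ∸ 1) H N
                    → All SmallSpanner trace × r ≤ length H + 2 * length N
  decremental-sound finish _ _ = [] , z≤n
  decremental-sound {H} (delNon {N' = N'} _ N↭ rest) greedy spans =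
    let spans' : Spans (2 * k ∸ 1) H N'
        spans' = spans ∘ ∈-resp-↭ (↭-sym N↭) ∘ there
        goods , r≤ = decremental-sound rest greedy spans'
        N'≤N = ≤-trans (n≤1+n (length N')) (≤-reflexive (sym (↭-length N↭)))
    in smallSpanner greedy spans' ∷ goods , ≤-trans r≤ (+-monoʳ-≤ (length H) (*-monoʳ-≤ 2 N'≤N))
  decremental-sound (delSpan _ H↭ order↭N pass rest) greedy _ =
    let greedy' = GreedyPass-greedy pass (HasGreedyOrder-delete H↭ greedy)
        spans'  = GreedyPass-spans pass
        goods , r≤ = decremental-sound rest greedy' spans'
    in smallSpanner greedy' spans' ∷ goods ,
       recourse-step (↭-length H↭)
                     (trans (GreedyPass-length pass) (cong (_ +_) (↭-length order↭N)))
                     (GreedyPass-grows pass) r≤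

initial-potential : ∀ h m {e} → h + m ≡ e → h + 2 * m ≤ 3 * e
initial-potential h m refl = ≤-trans (m≤m+n (h + 2 * m) (2 * h + m)) (≤-reflexive (regroup h m))
  where
    regroup : ∀ h m → h + 2 * m + (2 * h + m) ≡ 3 * (h + m)
    regroup = solve-∀

lemma5 : ∃[ C ] (∀ (k n : ℕ) → k ≥ 1 → (E : List (Edge n)) → SimpleGraph E
    → ∀ (order : List (Edge n)) → order ↭ E
    → ∀ (H₀ N₀ : List (Edge n)) → GreedyPass k order [] H₀ N₀
    → ∀ (ds : List (Edge n)) (trace : List (List (Edge n) × List (Edge n))) (r : ℕ)
    → Decremental k H₀ N₀ ds trace r
    → All (λ s → IsSpanner (2 * k ∸ 1) (proj₁ s) (proj₁ s ++ proj₂ s)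
    × length (proj₁ s) ^ k ≤ C ^ k * n ^ (k + 1))
    ((H₀ , N₀) ∷ trace)
    × r ≤ C * length E)
-- The input need not be simple: the greedy pass never keeps a loop or a parallel edge.
lemma5 = 3 , λ k n k≥1 E _ order order↭E H₀ N₀ pass ds trace r run →
  let open DecrementalGreedy {n} k k≥1
      greedy     = GreedyPass-greedy pass ([] , ↭-refl , tt)
      spans      = GreedyPass-spans pass
      goods , r≤ = decremental-sound run greedy spans
      |H₀|+|N₀|≡|E| = trans (GreedyPass-length pass) (↭-length order↭E)
  in smallSpanner greedy spans ∷ goods
   , ≤-trans r≤ (initial-potential (length H₀) (length N₀) |H₀|+|N₀|≡|E|)
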